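{- Let $G\neq K_1$ be a finite simple graph and let $n\ge 1$ be an integer. Then: 1. If $G$ is connected, then $\mathcal{D}_n[G]$ is eulerian if and only if $G$ is eulerian or $n$ is even. 2. If $G$ is Hamiltonian, then $\mathcal{D}_n[G]$ is Hamiltonian.
   Context: For an integer $n\ge1$, the total graph $T_n$ is the graph obtained from the complete graph $K_n$ by adding a loop at every vertex, so that any two of its vertices (equal or not) are adjacent. The Kronecker product $G\times H$ of graphs $G,H$ has vertex set $V(G)\times V(H)$, and $(u_1,v_1)$ is adjacent to $(u_2,v_2)$ if and only if $u_1$ is adjacent to $u_2$ in $G$ and $v_1$ is adjacent to $v_2$ in $H$. Define $\mathcal{D}_n[G]=G\times T_n$. Concretely, $(u,i)$ is adjacent to $(v,j)$ if and only if $uv\in E(G)$, for any $i,j\in\{0,\dots,n-1\}$. -}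

module Defs where

open import Data.Bool using (Bool; true; false)
open import Data.Nat using (ℕ; _≤_)
open import Data.Fin using (Fin)
open import Data.Product using (_×_; _,_; Σ; ∃)
open import Data.Sum using (_⊎_)
open import Data.List using (List; []; _∷_; length; lookup)
open import Data.List.Membership.Propositional using (_∈_)
open import Data.List.Relation.Unary.Unique.Propositional using (Unique)
open import Relation.Binary.PropositionalEquality using (_≡_)

record Graph (V : Set) : Set where
  field
    adj    : V → V → Bool
    sym    : ∀ u v → adj u v ≡ adj v u
    irrefl : ∀ v → adj v v ≡ false
open Graph public

-- A finite simple graph is a Graph (Fin m).

data Walk {V : Set} (G : Graph V) : V → V → Set where
  nil  : ∀ {v} → Walk G v v
  cons : ∀ {u v w} → adj G u v ≡ true → Walk G v w → Walk G u w

steps : ∀ {V} {G : Graph V} {u v} → Walk G u v → List (V × V)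
steps nil = []
steps (cons {u} {v} _ w) = (u , v) ∷ steps w

-- Vertices at which each step starts (for a closed walk: v0,...,v_{k-1}).
support : ∀ {V} {G : Graph V} {u v} → Walk G u v → List V
support nil = []
support (cons {u} _ w) = u ∷ support w

Connected : ∀ {V} → Graph V → Set
Connected G = ∀ u v → Walk G u v

SameEdge : ∀ {V : Set} → V → V → V × V → Set
SameEdge a b (x , y) = (x ≡ a × y ≡ b) ⊎ (x ≡ b × y ≡ a)

Eulerian : ∀ {V} → Graph V → Set
Eulerian {V} G =
  Σ V λ v → Σ (Walk G v v) λ w →
    ∀ a b → adj G a b ≡ true →
      Σ (Fin (length (steps w))) λ i →
        SameEdge a b (lookup (steps w) i) ×
        (∀ j → SameEdge a b (lookup (steps w) j) → j ≡ i)

Hamiltonian : ∀ {V} → Graph V → Set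
Hamiltonian {V} G =
  Σ V λ v → Σ (Walk G v v) λ w →
    (3 ≤ length (support w)) × Unique (support w) × (∀ x → x ∈ support w)

-- Total graph product: 𝒟 n G = G × T_n; (u,i) ~ (v,j) iff u ~ v in G.
𝒟 : ∀ {V} (n : ℕ) → Graph V → Graph (V × Fin n)
adj    (𝒟 n G) (u , i) (v , j) = adj G u v
sym    (𝒟 n G) (u , i) (v , j) = sym G u v
irrefl (𝒟 n G) (u , i)         = irrefl G u

-- The degree of (u , i) in 𝒟ₙ[G] is n · deg u, so all degrees of 𝒟ₙ[G] are even iff
-- n is even or all degrees of G are; and 𝒟ₙ[G] is connected when G is, because a
-- connected G on at least two vertices has no isolated vertex. Part 1 then follows
-- from Euler's theorem, proved here constructively with degree parities computed as
-- xor-sums over an enumeration of the vertices: a trail that cannot be extended at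
-- its end is closed, as otherwise the end would have odd degree; if a closed trail
-- misses an edge, connectivity yields a vertex of the trail with an unused edge, and
-- rotating the trail to start there lets it be extended.
-- For part 2, run the Hamiltonian cycle of G in layer 0, let its last edge step into
-- layer 1, run it there, and so on through all n layers.
module Submission where

open import Defs
open import Data.Nat using (ℕ; _≤_)
open import Data.Nat.Divisibility using (_∣_)
open import Data.Fin using (Fin)
open import Data.Product using (_×_)
open import Data.Sum using (_⊎_)
open import Function.Bundles using (_⇔_)

open import Data.Bool using (Bool; true; false; not; _∧_; _∨_; _xor_; if_then_else_)
open import Data.Bool.Properties
  using (xor-assoc; xor-comm; xor-same; ∧-zeroʳ; ∧-identityʳ; ∨-identityʳ; ∨-comm; ∧-comm)
  renaming (_≟_ to _≟ᵇ_)
open import Data.Empty using (⊥-elim)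
open import Data.Fin as Fin using (zero; suc)
open import Data.Fin.Properties using (0≢1+n) renaming (suc-injective to Fin-suc-injective)
open import Data.List
  using (List; []; _∷_; _++_; length; lookup; map; tabulate; allFin; cartesianProduct; cartesianProductWith)
open import Data.List.Properties using (length-++; length-map; length-tabulate; ++-identityʳ)
open import Data.List.Membership.Propositional using (_∈_; lose)
open import Data.List.Membership.Propositional.Properties
  using (∈-lookup; ∈-allFin; ∈-cartesianProduct⁺; ∈-cartesianProductWith⁺)
open import Data.List.Relation.Unary.All as All using ()
open import Data.List.Relation.Unary.AllPairs using (_∷_)
open import Data.List.Relation.Unary.Any using (here; there; any?; satisfied)
open import Data.List.Relation.Unary.Unique.Propositional using (Unique)
open import Data.List.Relation.Unary.Unique.Propositional.Properties
  using (allFin⁺; cartesianProduct⁺; cartesianProductWith⁺)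
open import Data.Nat as ℕ using (zero; suc; _+_; _*_; _∸_; _<_; z≤n; s≤s)
open import Data.Nat.Divisibility using (divides)
open import Data.Nat.Induction using (<-wellFounded)
open import Data.Nat.Properties
  using (module ≤-Reasoning; suc-injective; ≤-refl; ≤-reflexive; ≤-trans; <-≤-trans; ≤-antisym;
         n≢0⇒n>0; m≤n⇒m∸n≡0; m≤m+n; m≤n+m; +-comm; +-identityʳ; +-mono-≤; +-mono-<-≤; +-mono-≤-<;
         ∸-monoʳ-≤)
open import Data.Product using (Σ; ∃; _,_)
open import Data.Product.Properties using (≡-dec)
open import Data.Sum as Sum using (inj₁; inj₂)
open import Data.Sum.Function.Propositional using (_⊎-⇔_)
open import Function using (_∘_)
open import Function.Bundles using (mk⇔)
import Function.Properties.Equivalence as ⇔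
open import Function.Properties.Equivalence using (⇔-setoid)
open import Level using (0ℓ)
open import Induction.WellFounded using (Acc; acc)
open import Relation.Binary.Definitions using (DecidableEquality)
open import Relation.Binary.PropositionalEquality
  using (_≡_; _≢_; refl; cong; cong₂; subst; subst₂; module ≡-Reasoning)
  renaming (sym to ≡-sym; trans to ≡-trans)
open import Relation.Nullary using (¬_; Dec; yes; no; does)
open import Relation.Nullary.Decidable using (dec-true; dec-false; map′; _×-dec_; _⊎-dec_)
open import Relation.Unary using (Decidable)

false≢true : false ≢ true
false≢true ()

fromDoes : ∀ {A : Set} (d : Dec A) → does d ≡ true → A
fromDoes (yes a) _ = a

xor-cancel-middle : ∀ a b c → (a xor b) xor (b xor c) ≡ a xor c
xor-cancel-middle a b c = begin
  (a xor b) xor (b xor c)  ≡⟨ xor-assoc a b (b xor c) ⟩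
  a xor (b xor (b xor c))  ≡⟨ cong (a xor_) (≡-sym (xor-assoc b b c)) ⟩
  a xor ((b xor b) xor c)  ≡⟨ cong (λ t → a xor (t xor c)) (xor-same b) ⟩
  a xor c                  ∎
  where open ≡-Reasoning

xor-interchange : ∀ a b c d → (a xor b) xor (c xor d) ≡ (a xor c) xor (b xor d)
xor-interchange a b c d = begin
  (a xor b) xor (c xor d)  ≡⟨ xor-assoc a b (c xor d) ⟩
  a xor (b xor (c xor d))  ≡⟨ cong (a xor_) (≡-sym (xor-assoc b c d)) ⟩
  a xor ((b xor c) xor d)  ≡⟨ cong (λ t → a xor (t xor d)) (xor-comm b c) ⟩
  a xor ((c xor b) xor d)  ≡⟨ cong (a xor_) (xor-assoc c b d) ⟩
  a xor (c xor (b xor d))  ≡⟨ ≡-sym (xor-assoc a c (b xor d)) ⟩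
  (a xor c) xor (b xor d)  ∎
  where open ≡-Reasoning

odd : ℕ → Bool
odd zero = false
odd (suc zero) = true
odd (suc (suc n)) = odd n

odd-suc : ∀ n → odd (suc n) ≡ not (odd n)
odd-suc zero = refl
odd-suc (suc zero) = refl
odd-suc (suc (suc n)) = odd-suc n

odd≡false⇒2∣ : ∀ n → odd n ≡ false → 2 ∣ n
odd≡false⇒2∣ zero _ = divides 0 refl
odd≡false⇒2∣ (suc (suc n)) even with odd≡false⇒2∣ n even
... | divides q refl = divides (suc q) refl

2∣⇒odd≡false : ∀ n → 2 ∣ n → odd n ≡ false
2∣⇒odd≡false _ (divides q refl) = even-double q
  where
  even-double : ∀ q → odd (q * 2) ≡ false
  even-double zero = refl
  even-double (suc q) = even-double q

module _ {A : Set} where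

  xorSum : List A → (A → Bool) → Bool
  xorSum [] f = false
  xorSum (x ∷ xs) f = f x xor xorSum xs f

  xorSum-cong : ∀ xs {f g : A → Bool} → (∀ x → f x ≡ g x) → xorSum xs f ≡ xorSum xs g
  xorSum-cong [] f≗g = refl
  xorSum-cong (x ∷ xs) f≗g = cong₂ _xor_ (f≗g x) (xorSum-cong xs f≗g)

  xorSum-xor : ∀ xs f g → xorSum xs (λ x → f x xor g x) ≡ xorSum xs f xor xorSum xs g
  xorSum-xor [] f g = refl
  xorSum-xor (x ∷ xs) f g = ≡-trans (cong ((f x xor g x) xor_) (xorSum-xor xs f g))
                                    (xor-interchange (f x) (g x) (xorSum xs f) (xorSum xs g))

  xorSum-false : ∀ xs → xorSum xs (λ _ → false) ≡ false
  xorSum-false [] = refl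
  xorSum-false (x ∷ xs) = xorSum-false xs

  xorSum-∧ˡ : ∀ xs c f → xorSum xs (λ x → c ∧ f x) ≡ c ∧ xorSum xs f
  xorSum-∧ˡ xs false f = xorSum-false xs
  xorSum-∧ˡ xs true f = refl

  xorSum-const : ∀ xs c → xorSum xs (λ _ → c) ≡ c ∧ odd (length xs)
  xorSum-const xs false = xorSum-false xs
  xorSum-const [] true = refl
  xorSum-const (x ∷ xs) true = ≡-trans (cong not (xorSum-const xs true)) (≡-sym (odd-suc (length xs)))

  xorSum-++ : ∀ xs ys f → xorSum (xs ++ ys) f ≡ xorSum xs f xor xorSum ys f
  xorSum-++ [] ys f = refl
  xorSum-++ (x ∷ xs) ys f = ≡-trans (cong (f x xor_) (xorSum-++ xs ys f))
                                    (≡-sym (xor-assoc (f x) (xorSum xs f) (xorSum ys f)))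

  countᵇ : (A → Bool) → List A → ℕ
  countᵇ p [] = 0
  countᵇ p (x ∷ xs) = if p x then suc (countᵇ p xs) else countᵇ p xs

  odd-countᵇ-∷ : ∀ p x xs → odd (countᵇ p (x ∷ xs)) ≡ p x xor odd (countᵇ p xs)
  odd-countᵇ-∷ p x xs with p x
  ... | true = odd-suc (countᵇ p xs)
  ... | false = refl

  countᵇ-++ : ∀ p xs ys → countᵇ p (xs ++ ys) ≡ countᵇ p xs + countᵇ p ys
  countᵇ-++ p [] ys = refl
  countᵇ-++ p (x ∷ xs) ys with p x
  ... | true = cong suc (countᵇ-++ p xs ys)
  ... | false = countᵇ-++ p xs ys

  countᵇ-cong : ∀ {p q} xs → (∀ x → p x ≡ q x) → countᵇ p xs ≡ countᵇ q xs
  countᵇ-cong [] p≗q = refl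
  countᵇ-cong {q = q} (x ∷ xs) p≗q rewrite p≗q x with q x
  ... | true = cong suc (countᵇ-cong xs p≗q)
  ... | false = countᵇ-cong xs p≗q

  none⇒countᵇ≡0 : ∀ p xs → (∀ j → p (lookup xs j) ≢ true) → countᵇ p xs ≡ 0
  none⇒countᵇ≡0 p [] none = refl
  none⇒countᵇ≡0 p (x ∷ xs) none with p x in px
  ... | true = ⊥-elim (none zero px)
  ... | false = none⇒countᵇ≡0 p xs (none ∘ suc)

  countᵇ≡0⇒none : ∀ p xs → countᵇ p xs ≡ 0 → ∀ j → p (lookup xs j) ≢ true
  countᵇ≡0⇒none p (x ∷ xs) c≡0 zero with p x
  countᵇ≡0⇒none p (x ∷ xs) () zero | true
  ... | false = λ ()
  countᵇ≡0⇒none p (x ∷ xs) c≡0 (suc j) with p x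
  countᵇ≡0⇒none p (x ∷ xs) () (suc j) | true
  ... | false = countᵇ≡0⇒none p xs c≡0 j

  countᵇ≢0⇒∈ : ∀ p xs → countᵇ p xs ≢ 0 → ∃ λ x → x ∈ xs × p x ≡ true
  countᵇ≢0⇒∈ p [] c≢0 = ⊥-elim (c≢0 refl)
  countᵇ≢0⇒∈ p (x ∷ xs) c≢0 with p x in px
  ... | true = x , here refl , px
  ... | false = let y , y∈xs , py = countᵇ≢0⇒∈ p xs c≢0 in y , there y∈xs , py

  countᵇ≡1⇒∃! : ∀ p xs → countᵇ p xs ≡ 1 →
    Σ (Fin (length xs)) λ i → p (lookup xs i) ≡ true × (∀ j → p (lookup xs j) ≡ true → j ≡ i)
  countᵇ≡1⇒∃! p (x ∷ xs) c≡1 with p x in px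
  ... | true = zero , px , λ { zero _ → refl
                             ; (suc j) pj → ⊥-elim (countᵇ≡0⇒none p xs (suc-injective c≡1) j pj) }
  ... | false with countᵇ≡1⇒∃! p xs c≡1
  ... | i , pi , unique = suc i , pi , λ { zero pj → ⊥-elim (false≢true (≡-trans (≡-sym px) pj))
                                         ; (suc j) pj → cong suc (unique j pj) }

  ∃!⇒countᵇ≡1 : ∀ p xs (i : Fin (length xs)) → p (lookup xs i) ≡ true →
    (∀ j → p (lookup xs j) ≡ true → j ≡ i) → countᵇ p xs ≡ 1
  ∃!⇒countᵇ≡1 p (x ∷ xs) zero pi unique with p x
  ∃!⇒countᵇ≡1 p (x ∷ xs) zero pi unique | true =
    cong suc (none⇒countᵇ≡0 p xs λ j pj → 0≢1+n (≡-sym (unique (suc j) pj)))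
  ∃!⇒countᵇ≡1 p (x ∷ xs) zero () unique | false
  ∃!⇒countᵇ≡1 p (x ∷ xs) (suc i) pi unique with p x in px
  ... | true = ⊥-elim (0≢1+n (unique zero px))
  ... | false = ∃!⇒countᵇ≡1 p xs i pi (λ j pj → Fin-suc-injective (unique (suc j) pj))

xorSum-map : ∀ {A B : Set} (g : B → A) xs f → xorSum (map g xs) f ≡ xorSum xs (f ∘ g)
xorSum-map g [] f = refl
xorSum-map g (x ∷ xs) f = cong (f (g x) xor_) (xorSum-map g xs f)

xorSum-cartesianProduct : ∀ {A B : Set} (xs : List A) (ys : List B) f →
  xorSum (cartesianProduct xs ys) f ≡ xorSum xs (λ x → xorSum ys (λ y → f (x , y)))
xorSum-cartesianProduct [] ys f = refl
xorSum-cartesianProduct (x ∷ xs) ys f =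
  ≡-trans (xorSum-++ (map (x ,_) ys) (cartesianProduct xs ys) f)
          (cong₂ _xor_ (xorSum-map (x ,_) ys f) (xorSum-cartesianProduct xs ys f))

module _ {A : Set} where

  sumBy : (A → ℕ) → List A → ℕ
  sumBy f [] = 0
  sumBy f (x ∷ xs) = f x + sumBy f xs

  sumBy-cong : ∀ {f g} xs → (∀ x → f x ≡ g x) → sumBy f xs ≡ sumBy g xs
  sumBy-cong [] f≗g = refl
  sumBy-cong (x ∷ xs) f≗g = cong₂ _+_ (f≗g x) (sumBy-cong xs f≗g)

  sumBy-mono-≤ : ∀ {f g} xs → (∀ x → f x ≤ g x) → sumBy f xs ≤ sumBy g xs
  sumBy-mono-≤ [] f≤g = z≤n
  sumBy-mono-≤ (x ∷ xs) f≤g = +-mono-≤ (f≤g x) (sumBy-mono-≤ xs f≤g)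

  sumBy-mono-< : ∀ {f g} xs → (∀ x → f x ≤ g x) → ∀ {y} → y ∈ xs → f y < g y →
    sumBy f xs < sumBy g xs
  sumBy-mono-< (x ∷ xs) f≤g (here refl) fy<gy = +-mono-<-≤ fy<gy (sumBy-mono-≤ xs f≤g)
  sumBy-mono-< (x ∷ xs) f≤g (there y∈xs) fy<gy = +-mono-≤-< (f≤g x) (sumBy-mono-< xs f≤g y∈xs fy<gy)

module _ {V : Set} {G : Graph V} where

  _++ʷ_ : ∀ {x y z} → Walk G x y → Walk G y z → Walk G x z
  nil ++ʷ w′ = w′
  cons e w ++ʷ w′ = cons e (w ++ʷ w′)

  steps-++ʷ : ∀ {x y z} (w : Walk G x y) (w′ : Walk G y z) → steps (w ++ʷ w′) ≡ steps w ++ steps w′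
  steps-++ʷ nil w′ = refl
  steps-++ʷ (cons {u} {v} e w) w′ = cong ((u , v) ∷_) (steps-++ʷ w w′)

  support-++ʷ : ∀ {x y z} (w : Walk G x y) (w′ : Walk G y z) →
    support (w ++ʷ w′) ≡ support w ++ support w′
  support-++ʷ nil w′ = refl
  support-++ʷ (cons {u} e w) w′ = cong (u ∷_) (support-++ʷ w w′)

  _∈ᵛ_ : ∀ {x z} → V → Walk G x z → Set
  _∈ᵛ_ {z = z} y w = y ∈ support w ⊎ y ≡ z

  start∈ᵛ : ∀ {x z} (w : Walk G x z) → x ∈ᵛ w
  start∈ᵛ nil = inj₂ refl
  start∈ᵛ (cons e w) = inj₁ (here refl)

  step-adjacent : ∀ {x z} (w : Walk G x z) {p q} → (p , q) ∈ steps w → adj G p q ≡ true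
  step-adjacent (cons e w) (here refl) = e
  step-adjacent (cons e w) (there pq∈w) = step-adjacent w pq∈w

  step-source∈support : ∀ {x z} (w : Walk G x z) {p q} → (p , q) ∈ steps w → p ∈ support w
  step-source∈support (cons e w) (here refl) = here refl
  step-source∈support (cons e w) (there pq∈w) = there (step-source∈support w pq∈w)

  step-target∈ᵛ : ∀ {x z} (w : Walk G x z) {p q} → (p , q) ∈ steps w → q ∈ᵛ w
  step-target∈ᵛ (cons e w) (here refl) = Sum.map₁ there (start∈ᵛ w)
  step-target∈ᵛ (cons e w) (there pq∈w) = Sum.map₁ there (step-target∈ᵛ w pq∈w)

  splitAt : ∀ {x y z} (w : Walk G x z) → y ∈ support w →
    Σ (Walk G x y) λ w₁ → Σ (Walk G y z) λ w₂ → steps w ≡ steps w₁ ++ steps w₂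
  splitAt w@(cons e _) (here refl) = nil , w , refl
  splitAt (cons {u} {v} e w) (there y∈w) =
    let w₁ , w₂ , split = splitAt w y∈w in cons e w₁ , w₂ , cong ((u , v) ∷_) split

  rotate : ∀ {x y} (w : Walk G x x) → y ∈ᵛ w →
    Σ (Walk G y y) λ w′ → ∀ p → countᵇ p (steps w′) ≡ countᵇ p (steps w)
  rotate w (inj₂ refl) = w , λ p → refl
  rotate w (inj₁ y∈w) with splitAt w y∈w
  ... | w₁ , w₂ , split = w₂ ++ʷ w₁ , λ p → begin
    countᵇ p (steps (w₂ ++ʷ w₁))               ≡⟨ cong (countᵇ p) (steps-++ʷ w₂ w₁) ⟩
    countᵇ p (steps w₂ ++ steps w₁)            ≡⟨ countᵇ-++ p (steps w₂) (steps w₁) ⟩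
    countᵇ p (steps w₂) + countᵇ p (steps w₁)  ≡⟨ +-comm (countᵇ p (steps w₂)) _ ⟩
    countᵇ p (steps w₁) + countᵇ p (steps w₂)  ≡⟨ countᵇ-++ p (steps w₁) (steps w₂) ⟨
    countᵇ p (steps w₁ ++ steps w₂)            ≡⟨ cong (countᵇ p) split ⟨
    countᵇ p (steps w)                         ∎
    where open ≡-Reasoning

  adjacent⇒≢ : ∀ {u v} → adj G u v ≡ true → u ≢ v
  adjacent⇒≢ {u} u~u refl = false≢true (≡-trans (≡-sym (irrefl G u)) u~u)

  walk-leaves : ∀ {u v} → u ≢ v → Walk G u v → ∃ λ w → adj G u w ≡ true
  walk-leaves u≢u nil = ⊥-elim (u≢u refl)
  walk-leaves u≢v (cons {v = w} e _) = w , e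

record Enumeration (A : Set) : Set where
  field
    _≟_             : DecidableEquality A
    elements        : List A
    elements-unique : Unique elements
    ∈-elements      : ∀ x → x ∈ elements

  ∃? : {P : A → Set} → Decidable P → Dec (∃ P)
  ∃? P? = map′ satisfied (λ (x , px) → lose (∈-elements x) px) (any? P? elements)

finEnumeration : ∀ n → Enumeration (Fin n)
finEnumeration n = record
  { _≟_ = Fin._≟_ ; elements = allFin n ; elements-unique = allFin⁺ n ; ∈-elements = ∈-allFin }

_×ᴱ_ : ∀ {A B} → Enumeration A → Enumeration B → Enumeration (A × B)
E ×ᴱ F = record
  { _≟_ = ≡-dec E._≟_ F._≟_
  ; elements = cartesianProduct E.elements F.elements
  ; elements-unique = cartesianProduct⁺ E.elements-unique F.elements-unique
  ; ∈-elements = λ (x , y) → ∈-cartesianProduct⁺ (E.∈-elements x) (F.∈-elements y)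
  }
  where module E = Enumeration E
        module F = Enumeration F

module Euler {V : Set} (E : Enumeration V) (G : Graph V) where
  open Enumeration E

  _==_ : V → V → Bool
  a == b = does (a ≟ b)

  ==-refl : ∀ a → (a == a) ≡ true
  ==-refl a = dec-true (a ≟ a) refl

  ==-false : ∀ {a b} → a ≢ b → (a == b) ≡ false
  ==-false {a} {b} = dec-false (a ≟ b)

  xorSum-==-∉ : ∀ y xs → ¬ y ∈ xs → xorSum xs (y ==_) ≡ false
  xorSum-==-∉ y [] y∉xs = refl
  xorSum-==-∉ y (x ∷ xs) y∉xs rewrite ==-false (y∉xs ∘ here) = xorSum-==-∉ y xs (y∉xs ∘ there)

  xorSum-==-unique : ∀ y xs → Unique xs → y ∈ xs → xorSum xs (y ==_) ≡ true
  xorSum-==-unique y (x ∷ xs) (x∉xs ∷ unique) (here refl) rewrite ==-refl y =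
    cong not (xorSum-==-∉ y xs λ y∈xs → All.lookup x∉xs y∈xs refl)
  xorSum-==-unique y (x ∷ xs) (x∉xs ∷ unique) (there y∈xs)
    rewrite ==-false {y} {x} (λ { refl → All.lookup x∉xs y∈xs refl }) = xorSum-==-unique y xs unique y∈xs

  traverses? : ∀ a b s → Dec (SameEdge a b s)
  traverses? a b (x , y) = ((x ≟ a) ×-dec (y ≟ b)) ⊎-dec ((x ≟ b) ×-dec (y ≟ a))

  traverses : V → V → V × V → Bool
  traverses a b s = does (traverses? a b s)

  traverses-complete : ∀ {a b} s → SameEdge a b s → traverses a b s ≡ true
  traverses-complete {a} {b} s = dec-true (traverses? a b s)

  traverses-sym : ∀ a b s → traverses a b s ≡ traverses b a s
  traverses-sym a b (x , y) = ∨-comm ((x == a) ∧ (y == b)) ((x == b) ∧ (y == a))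

  sameEdge-adjacent : ∀ {a b p q} → SameEdge a b (p , q) → adj G p q ≡ true → adj G a b ≡ true
  sameEdge-adjacent {a} {b} (inj₁ (refl , refl)) a~b = a~b
  sameEdge-adjacent {a} {b} (inj₂ (refl , refl)) b~a = ≡-trans (sym G a b) b~a

  uses : ∀ {x z} → Walk G x z → V → V → ℕ
  uses w a b = countᵇ (traverses a b) (steps w)

  uses-sym : ∀ {x z} (w : Walk G x z) a b → uses w a b ≡ uses w b a
  uses-sym w a b = countᵇ-cong (steps w) (traverses-sym a b)

  uses-nonadjacent : ∀ {x z} (w : Walk G x z) a b → adj G a b ≡ false → uses w a b ≡ 0
  uses-nonadjacent w a b a≁b = none⇒countᵇ≡0 (traverses a b) (steps w) λ j t →
    false≢true (≡-trans (≡-sym a≁b)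
      (sameEdge-adjacent (fromDoes (traverses? a b _) t) (step-adjacent w (∈-lookup j))))

  stepParity : ∀ {x y} → x ≢ y → ∀ a →
    xorSum elements (λ b → traverses a b (x , y)) ≡ (a == x) xor (a == y)
  stepParity {x} {y} x≢y a with a ≟ x | a ≟ y
  ... | yes refl | yes refl = ⊥-elim (x≢y refl)
  ... | yes refl | no a≢y rewrite ==-refl a | ==-false (a≢y ∘ ≡-sym) =
    ≡-trans (xorSum-cong elements λ b →
               ≡-trans (cong ((y == b) ∨_) (∧-zeroʳ (a == b))) (∨-identityʳ (y == b)))
            (xorSum-==-unique y elements elements-unique (∈-elements y))
  ... | no a≢x | yes refl rewrite ==-refl a | ==-false (a≢x ∘ ≡-sym) =
    ≡-trans (xorSum-cong elements λ b → ∧-identityʳ (x == b))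
            (xorSum-==-unique x elements elements-unique (∈-elements x))
  ... | no a≢x | no a≢y rewrite ==-false (a≢x ∘ ≡-sym) | ==-false (a≢y ∘ ≡-sym) =
    ≡-trans (xorSum-cong elements λ b → ∧-zeroʳ (x == b)) (xorSum-false elements)

  walkParity : ∀ {x z} (w : Walk G x z) a →
    xorSum elements (λ b → odd (uses w a b)) ≡ (a == x) xor (a == z)
  walkParity {x} nil a = ≡-trans (xorSum-false elements) (≡-sym (xor-same (a == x)))
  walkParity {x} {z} (cons {v = y} e w) a = begin
    xorSum elements (λ b → odd (uses (cons e w) a b))
      ≡⟨ xorSum-cong elements (λ b → odd-countᵇ-∷ (traverses a b) (x , y) (steps w)) ⟩
    xorSum elements (λ b → traverses a b (x , y) xor odd (uses w a b))
      ≡⟨ xorSum-xor elements (λ b → traverses a b (x , y)) (λ b → odd (uses w a b)) ⟩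
    xorSum elements (λ b → traverses a b (x , y)) xor xorSum elements (λ b → odd (uses w a b))
      ≡⟨ cong₂ _xor_ (stepParity (adjacent⇒≢ {G = G} e) a) (walkParity w a) ⟩
    ((a == x) xor (a == y)) xor ((a == y) xor (a == z))
      ≡⟨ xor-cancel-middle (a == x) (a == y) (a == z) ⟩
    (a == x) xor (a == z)
      ∎
    where open ≡-Reasoning

  degreeParity : V → Bool
  degreeParity a = xorSum elements (adj G a)

  EvenDegrees : Set
  EvenDegrees = ∀ a → degreeParity a ≡ false

  CoversEdgesAt : ∀ {x z} → Walk G x z → V → Set
  CoversEdgesAt w a = ∀ b → adj G a b ≡ true → uses w a b ≡ 1

  degreeParity-covered : ∀ {x z} (w : Walk G x z) a → CoversEdgesAt w a →
    degreeParity a ≡ (a == x) xor (a == z)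
  degreeParity-covered w a covers = ≡-trans (xorSum-cong elements adj≡odd-uses) (walkParity w a)
    where
    adj≡odd-uses : ∀ b → adj G a b ≡ odd (uses w a b)
    adj≡odd-uses b with adj G a b in a~b
    ... | true = ≡-sym (cong odd (covers b a~b))
    ... | false = ≡-sym (cong odd (uses-nonadjacent w a b a~b))

  eulerian⇒coveringCircuit : Eulerian G → Σ V λ v → Σ (Walk G v v) λ w → ∀ a → CoversEdgesAt w a
  eulerian⇒coveringCircuit (v , w , once) = v , w , λ a b a~b →
    let i , i-traverses , unique = once a b a~b in
    ∃!⇒countᵇ≡1 (traverses a b) (steps w) i (traverses-complete _ i-traverses)
      (λ j j-traverses → unique j (fromDoes (traverses? a b _) j-traverses))

  coveringCircuit⇒eulerian : ∀ {v} (w : Walk G v v) → (∀ a → CoversEdgesAt w a) → Eulerian G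
  coveringCircuit⇒eulerian w covers = _ , w , λ a b a~b →
    let i , i-traverses , unique = countᵇ≡1⇒∃! (traverses a b) (steps w) (covers a b a~b) in
    i , fromDoes (traverses? a b _) i-traverses , λ j j-traverses → unique j (traverses-complete _ j-traverses)

  eulerian⇒evenDegrees : Eulerian G → EvenDegrees
  eulerian⇒evenDegrees eulerian a =
    let v , w , covers = eulerian⇒coveringCircuit eulerian in
    ≡-trans (degreeParity-covered w a (covers a)) (xor-same (a == v))

  Unused : ∀ {x z} → Walk G x z → V → V → Set
  Unused w a b = adj G a b ≡ true × uses w a b ≡ 0

  unused? : ∀ {x z} (w : Walk G x z) a b → Dec (Unused w a b)
  unused? w a b = (adj G a b ≟ᵇ true) ×-dec (uses w a b ℕ.≟ 0)

  used⇒uses≡1 : ∀ {x z} (w : Walk G x z) {a b} → uses w a b ≤ 1 → ¬ Unused w a b →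
    adj G a b ≡ true → uses w a b ≡ 1
  used⇒uses≡1 w once used a~b = ≤-antisym once (n≢0⇒n>0 λ unused → used (a~b , unused))

  record Trail : Set where
    constructor trail
    field
      {start end}    : V
      walk           : Walk G start end
      usedAtMostOnce : ∀ a b → uses walk a b ≤ 1

  -- Non-edges are counted too; they never become traversed, so only the measure's
  -- decrease matters.
  untraversedPairs : ∀ {x z} → Walk G x z → ℕ
  untraversedPairs w = sumBy (λ (a , b) → 1 ∸ uses w a b) (cartesianProduct elements elements)

  untraversed : Trail → ℕ
  untraversed T = untraversedPairs (Trail.walk T)

  untraversedPairs-cong : ∀ {x z x′ z′} (w : Walk G x z) (w′ : Walk G x′ z′) →
    (∀ a b → uses w a b ≡ uses w′ a b) → untraversedPairs w ≡ untraversedPairs w′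
  untraversedPairs-cong w w′ same =
    sumBy-cong (cartesianProduct elements elements) λ (a , b) → cong (1 ∸_) (same a b)

  untraversedPairs-< : ∀ {x z x′ z′} (w : Walk G x z) (w′ : Walk G x′ z′) →
    (∀ a b → uses w a b ≤ uses w′ a b) → ∀ {a b} → uses w a b ≡ 0 → 1 ≤ uses w′ a b →
    untraversedPairs w′ < untraversedPairs w
  untraversedPairs-< w w′ w≤w′ {a} {b} unused used =
    sumBy-mono-< (cartesianProduct elements elements) (λ (a , b) → ∸-monoʳ-≤ 1 (w≤w′ a b))
      (∈-cartesianProduct⁺ (∈-elements a) (∈-elements b))
      (subst₂ _<_ (≡-sym (m≤n⇒m∸n≡0 used)) (cong (1 ∸_) (≡-sym unused)) (s≤s z≤n))

  _▷_ : ∀ {x z b} → Walk G x z → adj G z b ≡ true → Walk G x b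
  w ▷ e = w ++ʷ cons e nil

  uses-▷ : ∀ {x z b} (w : Walk G x z) (e : adj G z b ≡ true) a p →
    uses (w ▷ e) a p ≡ uses w a p + countᵇ (traverses a p) ((z , b) ∷ [])
  uses-▷ w e a p = ≡-trans (cong (countᵇ (traverses a p)) (steps-++ʷ w (cons e nil)))
                           (countᵇ-++ (traverses a p) (steps w) _)

  ▷-usedAtMostOnce : ∀ {x z b} (w : Walk G x z) (e : adj G z b ≡ true) → uses w z b ≡ 0 →
    (∀ a p → uses w a p ≤ 1) → ∀ a p → uses (w ▷ e) a p ≤ 1
  ▷-usedAtMostOnce {z = z} {b} w e unused once a p rewrite uses-▷ w e a p
    with traverses a p (z , b) in t
  ... | false = subst (_≤ 1) (≡-sym (+-identityʳ _)) (once a p)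
  ... | true with fromDoes (traverses? a p (z , b)) t
  ... | inj₁ (refl , refl) rewrite unused = ≤-refl
  ... | inj₂ (refl , refl) rewrite uses-sym w a p | unused = ≤-refl

  extend : (T : Trail) → ∀ {b} → Unused (Trail.walk T) (Trail.end T) b →
    Σ Trail λ T′ → untraversed T′ < untraversed T
  extend (trail {end = z} w once) {b} (e , unused) =
    trail (w ▷ e) (▷-usedAtMostOnce w e unused once) ,
    untraversedPairs-< w (w ▷ e) uses-increase unused new-edge-used
    where
    uses-increase : ∀ a p → uses w a p ≤ uses (w ▷ e) a p
    uses-increase a p = ≤-trans (m≤m+n _ _) (≤-reflexive (≡-sym (uses-▷ w e a p)))
    new-edge-used : 1 ≤ uses (w ▷ e) z b
    new-edge-used rewrite uses-▷ w e z b | traverses-complete {z} {b} (z , b) (inj₁ (refl , refl)) =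
      m≤n+m 1 (uses w z b)

  -- On a path from the circuit to an unused edge, the first edge not traversed by
  -- the circuit starts on the circuit.
  unusedEdgeOnCircuit : ∀ {x u a b} (w : Walk G x x) → Walk G u a → u ∈ᵛ w → Unused w a b →
    Σ V λ y → Σ V λ b′ → y ∈ᵛ w × Unused w y b′
  unusedEdgeOnCircuit w nil u∈w unused = _ , _ , u∈w , unused
  unusedEdgeOnCircuit {u = u} w (cons {v = v} e path) u∈w unused with uses w u v ℕ.≟ 0
  ... | yes unused′ = u , v , u∈w , e , unused′
  ... | no used with countᵇ≢0⇒∈ (traverses u v) (steps w) used
  ... | (p , q) , pq∈w , t with fromDoes (traverses? u v (p , q)) t
  ... | inj₁ (refl , refl) = unusedEdgeOnCircuit w path (step-target∈ᵛ w pq∈w) unused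
  ... | inj₂ (refl , refl) = unusedEdgeOnCircuit w path (inj₁ (step-source∈support w pq∈w)) unused

  module _ (connected : Connected G) (even : EvenDegrees) where

    stuck⇒closed : ∀ {x z} (w : Walk G x z) → (∀ a b → uses w a b ≤ 1) → ¬ ∃ (Unused w z) → z ≡ x
    stuck⇒closed {x} {z} w once stuck with z ≟ x
    ... | yes z≡x = z≡x
    ... | no z≢x = ⊥-elim (false≢true (begin
      false                  ≡⟨ even z ⟨
      degreeParity z         ≡⟨ degreeParity-covered w z covers ⟩
      (z == x) xor (z == z)  ≡⟨ cong₂ _xor_ (==-false z≢x) (==-refl z) ⟩
      true                   ∎))
      where
      open ≡-Reasoning
      covers : CoversEdgesAt w z
      covers b = used⇒uses≡1 w (once z b) (λ unused → stuck (b , unused))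

    progress : (T : Trail) →
      Eulerian G ⊎ Σ Trail λ T′ → untraversed T′ < untraversed T
    progress T@(trail {x} {z} w once) with ∃? (unused? w z)
    ... | yes (b , unused) = inj₂ (extend T unused)
    ... | no stuck with stuck⇒closed w once stuck
    ... | refl with ∃? (λ a → ∃? (unused? w a))
    ... | no allUsed = inj₁ (coveringCircuit⇒eulerian w λ a b →
            used⇒uses≡1 w (once a b) (λ unused → allUsed (a , b , unused)))
    ... | yes (a , b , unused) with unusedEdgeOnCircuit w (connected x a) (inj₂ refl) unused
    ... | y , b′ , y∈w , e , unused′ with rotate w y∈w
    ... | w′ , rotated =
      let same a b = rotated (traverses a b)
          T′ , smaller = extend (trail w′ λ a b → subst (_≤ 1) (≡-sym (same a b)) (once a b))
                                (e , ≡-trans (same y b′) unused′)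
      in inj₂ (T′ , <-≤-trans smaller (≤-reflexive (untraversedPairs-cong w′ w same)))

    evenDegrees⇒eulerian : V → Eulerian G
    evenDegrees⇒eulerian v = go (trail (nil {v = v}) λ _ _ → z≤n) (<-wellFounded _)
      where
      go : (T : Trail) → Acc _<_ (untraversed T) → Eulerian G
      go T (acc smaller) with progress T
      ... | inj₁ eulerian = eulerian
      ... | inj₂ (T′ , T′<T) = go T′ (smaller T′<T)

  eulerian⇔evenDegrees : Connected G → V → Eulerian G ⇔ EvenDegrees
  eulerian⇔evenDegrees connected v =
    mk⇔ eulerian⇒evenDegrees (λ even → evenDegrees⇒eulerian connected even v)

connected⇒noIsolated : ∀ {V} {G : Graph V} → Connected G → (∀ u → ∃ λ v → u ≢ v) →
  ∀ u → ∃ λ v → adj G u v ≡ true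
connected⇒noIsolated connected other u = let v , u≢v = other u in walk-leaves u≢v (connected u v)

Fin-nontrivial : ∀ {m} (u : Fin (suc (suc m))) → ∃ λ v → u ≢ v
Fin-nontrivial zero = suc zero , λ ()
Fin-nontrivial (suc _) = zero , λ ()

module _ {V : Set} {G : Graph V} {n : ℕ} where

  liftʷ : ∀ {u v x} → adj G u v ≡ true → Walk G v x → ∀ i j → Walk (𝒟 n G) (u , i) (x , j)
  liftʷ e nil i j = cons e nil
  liftʷ e (cons e′ w) i j = cons {v = _ , i} e (liftʷ e′ w i j)

  support-liftʷ : ∀ {u v x} (e : adj G u v ≡ true) (w : Walk G v x) i j →
    support (liftʷ e w i j) ≡ map (_, i) (support (cons e w))
  support-liftʷ e nil i j = refl
  support-liftʷ {u} e (cons e′ w) i j = cong ((u , i) ∷_) (support-liftʷ e′ w i j)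

  𝒟-connected : (∀ u → ∃ λ v → adj G u v ≡ true) → Connected G → Connected (𝒟 n G)
  𝒟-connected neighbour connected (u , i) (v , j) with connected u v
  ... | nil = let w , u~w = neighbour u in liftʷ u~w (cons (≡-trans (sym G w u) u~w) nil) i j
  ... | cons e path = liftʷ e path i j

  layeredCycle : ∀ {v v′} (e : adj G v v′ ≡ true) (w : Walk G v′ v) i is j →
    Σ (Walk (𝒟 n G) (v , i) (v , j)) λ c →
      support c ≡ cartesianProductWith (λ k a → a , k) (i ∷ is) (support (cons e w))
  layeredCycle e w i [] j = liftʷ e w i j , ≡-trans (support-liftʷ e w i j) (≡-sym (++-identityʳ _))
  layeredCycle e w i (i′ ∷ is) j =
    let c , support-c = layeredCycle e w i′ is j in
    liftʷ e w i i′ ++ʷ c ,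
    ≡-trans (support-++ʷ (liftʷ e w i i′) c) (cong₂ _++_ (support-liftʷ e w i i′) support-c)

𝒟-hamiltonian : ∀ {V} {G : Graph V} {k} → Hamiltonian G → Hamiltonian (𝒟 (suc k) G)
𝒟-hamiltonian (v , nil , () , _)
𝒟-hamiltonian {k = k} (v , cons e w , 3≤length , unique , complete)
  with layeredCycle e w zero (tabulate suc) zero
... | c , support-c = (v , zero) , c , long , unique′ , complete′
  where
  S = support (cons e w)
  inLayer : Fin (suc k) → _ → _
  inLayer i a = a , i
  inLayer-injective : ∀ {i j a b} → inLayer i a ≡ inLayer j b → i ≡ j × a ≡ b
  inLayer-injective refl = refl , refl
  higherLayers = cartesianProductWith inLayer (tabulate suc) S
  unique′ : Unique (support c)
  unique′ = subst Unique (≡-sym support-c)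
    (cartesianProductWith⁺ inLayer inLayer-injective (allFin⁺ (suc k)) unique)
  complete′ : ∀ p → p ∈ support c
  complete′ (a , i) = subst ((a , i) ∈_) (≡-sym support-c)
    (∈-cartesianProductWith⁺ inLayer (∈-allFin i) (complete a))
  long : 3 ≤ length (support c)
  long = begin
    3                                   ≤⟨ 3≤length ⟩
    length S                            ≡⟨ length-map (inLayer zero) S ⟨
    length (map (inLayer zero) S)       ≤⟨ m≤m+n _ (length higherLayers) ⟩
    length (map (inLayer zero) S) + length higherLayers
                                        ≡⟨ length-++ (map (inLayer zero) S) ⟨
    length (map (inLayer zero) S ++ higherLayers)
                                        ≡⟨ cong length support-c ⟨
    length (support c)                  ∎
    where open ≤-Reasoning

module _ {V : Set} (E : Enumeration V) (G : Graph V) (n : ℕ) where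
  private
    module EG = Euler E G
    module E𝒟 = Euler (E ×ᴱ finEnumeration n) (𝒟 n G)
    open Enumeration E

  degreeParity-𝒟 : ∀ u i → E𝒟.degreeParity (u , i) ≡ odd n ∧ EG.degreeParity u
  degreeParity-𝒟 u i = begin
    xorSum (cartesianProduct elements (allFin n)) (adj (𝒟 n G) (u , i))
      ≡⟨ xorSum-cartesianProduct elements (allFin n) (adj (𝒟 n G) (u , i)) ⟩
    xorSum elements (λ v → xorSum (allFin n) (λ _ → adj G u v))
      ≡⟨ xorSum-cong elements (λ v → xorSum-const (allFin n) (adj G u v)) ⟩
    xorSum elements (λ v → adj G u v ∧ odd (length (allFin n)))
      ≡⟨ xorSum-cong elements (λ v →
           ≡-trans (cong (λ l → adj G u v ∧ odd l) (length-tabulate {n = n} (λ i → i)))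
                   (∧-comm (adj G u v) (odd n))) ⟩
    xorSum elements (λ v → odd n ∧ adj G u v)
      ≡⟨ xorSum-∧ˡ elements (odd n) (adj G u) ⟩
    odd n ∧ EG.degreeParity u
      ∎
    where open ≡-Reasoning

  𝒟-evenDegrees⇔ : Fin n → E𝒟.EvenDegrees ⇔ (EG.EvenDegrees ⊎ 2 ∣ n)
  𝒟-evenDegrees⇔ i₀ = mk⇔ to from
    where
    to : E𝒟.EvenDegrees → EG.EvenDegrees ⊎ 2 ∣ n
    to even𝒟 with odd n in n-parity
    ... | false = inj₂ (odd≡false⇒2∣ n n-parity)
    ... | true = inj₁ λ u →
      ≡-trans (≡-sym (≡-trans (degreeParity-𝒟 u i₀) (cong (_∧ _) n-parity))) (even𝒟 (u , i₀))
    from : EG.EvenDegrees ⊎ 2 ∣ n → E𝒟.EvenDegrees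
    from (inj₁ evenG) (u , i) =
      ≡-trans (degreeParity-𝒟 u i) (≡-trans (cong (odd n ∧_) (evenG u)) (∧-zeroʳ (odd n)))
    from (inj₂ 2∣n) (u , i) = ≡-trans (degreeParity-𝒟 u i) (cong (_∧ _) (2∣⇒odd≡false n 2∣n))

proposition1p5 : ∀ {m : ℕ} (G : Graph (Fin m)) (n : ℕ) → 2 ≤ m → 1 ≤ n →
    (Connected G → (Eulerian (𝒟 n G) ⇔ (Eulerian G ⊎ 2 ∣ n)))
    × (Hamiltonian G → Hamiltonian (𝒟 n G))
proposition1p5 {m} G n (s≤s (s≤s _)) (s≤s z≤n) = eulerian , 𝒟-hamiltonian
  where
  E = finEnumeration m
  E𝒟 = E ×ᴱ finEnumeration n
  eulerian : Connected G → Eulerian (𝒟 n G) ⇔ (Eulerian G ⊎ 2 ∣ n)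
  eulerian connected = begin
    Eulerian (𝒟 n G)
      ≈⟨ Euler.eulerian⇔evenDegrees E𝒟 (𝒟 n G)
           (𝒟-connected (connected⇒noIsolated connected Fin-nontrivial) connected) (zero , zero) ⟩
    Euler.EvenDegrees E𝒟 (𝒟 n G)
      ≈⟨ 𝒟-evenDegrees⇔ E G n zero ⟩
    (Euler.EvenDegrees E G ⊎ 2 ∣ n)
      ≈⟨ Euler.eulerian⇔evenDegrees E G connected zero ⊎-⇔ ⇔.refl ⟨
    (Eulerian G ⊎ 2 ∣ n)
      ∎
    where open import Relation.Binary.Reasoning.Setoid (⇔-setoid 0ℓ)
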